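{- Let $G$ be a 2-connected simple graph satisfying $(\spadesuit)_2$. Suppose $v_1,v_2$ are vertices such that $G\setminus\{v_1,v_2\}$ is disconnected, and let $H_1,\dots,H_n$ be the connected components of $G\setminus\{v_1,v_2\}$. Then (1) $n=2$; (2) there is no edge between $v_1$ and $v_2$; (3) $G\setminus H_i$ is 2-connected for every $i$.
   Context: A graph is 2-connected if connected, with at least two vertices and no cut vertex (a single edge counts as 2-connected). A 2-connected simple graph $H=(V,E)$ satisfies $(\spadesuit)_2$ if $|E|=2(|V|-1)$ and $|E(S)|=2|S|-3$ for every good flat $S\subset V$, where $E(S)$ is the set of edges with both ends in $S$ and $S$ is a good flat if $H|_S$ is 2-connected and the graph obtained from $H$ by contracting all edges of $E(S)$ is 2-connected. $G\setminus H_i$ denotes the subgraph induced by the vertices not in $H_i$. -}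

module Defs where

open import Data.Nat using (ℕ; zero; suc; _+_; _*_; _∸_; _≤_; _<ᵇ_)
open import Data.Bool using (Bool; true; false; _∧_; if_then_else_)
open import Data.Fin using (Fin; toℕ)
open import Data.Fin.Subset using (Subset; _∈_; _∉_; ∣_∣)
open import Data.Vec using (lookup)
open import Data.List using (List; map; allFin)
open import Data.Nat.ListAction using (sum)
open import Data.Maybe using (Maybe; just; nothing)
open import Data.Product using (Σ; _×_; ∃; ∃-syntax; _,_)
open import Data.Unit using (⊤)
open import Data.Empty using (⊥)
open import Relation.Nullary using (¬_)
open import Relation.Binary.PropositionalEquality using (_≡_; _≢_)

data Reach {V : Set} (_~_ : V → V → Set) (P : V → Set) : V → V → Set where
  here : ∀ {x} → P x → Reach _~_ P x x
  step : ∀ {x y z} → P x → x ~ y → Reach _~_ P y z → Reach _~_ P x z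

Connected : {V : Set} → (V → V → Set) → (V → Set) → Set
Connected {V} _~_ P =
  (∃[ x ] P x) × (∀ x y → P x → P y → Reach _~_ P x y)

TwoConnected : {V : Set} → (V → V → Set) → (V → Set) → Set
TwoConnected {V} _~_ P =
  (Σ V λ x → Σ V λ y → P x × P y × x ≢ y)
  × Connected _~_ P
  × (∀ x → P x → Connected _~_ (λ y → P y × y ≢ x))

record Graph : Set where
  field
    N      : ℕ
    adj    : Fin N → Fin N → Bool
    sym    : ∀ i j → adj i j ≡ adj j i
    irrefl : ∀ i → adj i i ≡ false

module _ (G : Graph) where
  open Graph G

  Adj : Fin N → Fin N → Set
  Adj u v = adj u v ≡ true

  All : Fin N → Set
  All _ = ⊤

  edgesIn : Subset N → ℕ
  edgesIn S = sum (map (λ i → sum (map (λ j →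
      if (toℕ i <ᵇ toℕ j) ∧ lookup S i ∧ lookup S j ∧ adj i j
      then 1 else 0) (allFin N))) (allFin N))

  numEdges : ℕ
  numEdges = edgesIn (Data.Fin.Subset.⊤)

  -- Graph H/E(S) obtained by contracting all edges with both ends in S
  -- (for H|_S connected this identifies S to a single vertex `nothing`;
  -- loops are discarded, parallel edges are irrelevant for connectivity).
  ContrV : Subset N → Maybe (Fin N) → Set
  ContrV S nothing  = ⊤
  ContrV S (just v) = v ∉ S

  ContrAdj : Subset N → Maybe (Fin N) → Maybe (Fin N) → Set
  ContrAdj S (just u) (just v) = Adj u v
  ContrAdj S nothing  (just v) = ∃[ u ] (u ∈ S × Adj u v)
  ContrAdj S (just u) nothing  = ∃[ v ] (v ∈ S × Adj u v)
  ContrAdj S nothing  nothing  = ⊥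

  GoodFlat : Subset N → Set
  GoodFlat S = TwoConnected Adj (_∈ S) × TwoConnected (ContrAdj S) (ContrV S)

  Spade2 : Set
  Spade2 = (numEdges ≡ 2 * (N ∸ 1))
         × (∀ S → GoodFlat S → edgesIn S + 3 ≡ 2 * ∣ S ∣)

  IsComponent : (Fin N → Set) → Subset N → Set
  IsComponent W C =
      (∀ x → x ∈ C → W x)
    × Connected Adj (_∈ C)
    × (∀ x y → x ∈ C → W y → Adj x y → y ∈ C)

  AreComponents : (Fin N → Set) → (n : ℕ) → (Fin n → Subset N) → Set
  AreComponents W n H =
      (∀ i → IsComponent W (H i))
    × (∀ i j → i ≢ j → ∀ x → x ∈ H i → x ∉ H j)
    × (∀ x → W x → ∃[ i ] x ∈ H i)

module Submission where

-- Fix the separating pair {u, w} and call K a lobe when the vertices outside X = K ∪ {u, w}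
-- form a nonempty connected set with no edge to K.  Induction on |K| shows |E(X)| ≤ 2|K| + 1,
-- with equality only if X is 2-connected: if some c ∈ K cuts X, then X splits at c into two
-- smaller lobes (with ends u, c and w, c) whose bounds add up to 2|K|; otherwise X is
-- 2-connected, its complement is connected, so X is a good flat and (♠)₂ gives 2|K| + 1.
-- As |E| = 2(|V| − 1), passing to complements shows that a nonempty proper union Z of
-- components of G ∖ {u, w} meets at least 2|Z| + 1 edges, and at least 2|Z| + 2 if Z is
-- disconnected (split Z into two smaller such unions).  Now let Z be a component and Z′ the rest
-- of G ∖ {u, w}.  The lobe bound allows at most 2|Z′| + 1 edges inside Z′ ∪ {u, w}, and the
-- edges meeting Z′ alone already use them all: so Z′ is connected (hence the only other
-- component), u and w are not adjacent, and Z′ ∪ {u, w} is 2-connected.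

open import Defs
open import Level using (0ℓ)
open import Data.Bool using (true; false; _∧_; if_then_else_)
open import Data.Bool.Properties using (T-≡; ∧-zeroʳ; ∧-identityʳ)
open import Data.Empty using (⊥; ⊥-elim)
open import Data.Fin using (Fin; zero; suc; toℕ)
open import Data.Fin.Properties using (_≟_; suc-injective; toℕ-injective; any?)
open import Data.Fin.Subset using (Subset; _∉_)
import Data.Fin.Subset as Subset
open import Data.Fin.Subset.Properties using (_∈?_)
import Data.List as List using (map; allFin; tabulate)
open import Data.List.Properties using (map-tabulate)
import Data.Nat.ListAction as List using (sum)
open import Data.Maybe using (Maybe; just; nothing)
open import Data.Nat using (ℕ; zero; suc; _+_; _*_; _∸_; _≤_; _<_; z≤n; s≤s; _<ᵇ_)
open import Data.Nat.Induction using (<-wellFounded)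
open import Data.Nat.Properties hiding (_≟_; suc-injective)
open import Data.Nat.Tactic.RingSolver using (solve-∀)
open import Algebra.Properties.CommutativeMonoid.Sum +-0-commutativeMonoid
  using (sum; sum-syntax; ∑-distrib-+; sum-cong-≗; sum-replicate-zero)
open import Data.Product using (_×_; ∃; ∃₂; _,_; proj₁; proj₂)
open import Data.Sum using (_⊎_; inj₁; inj₂; [_,_]′) renaming (map to map-⊎)
open import Data.Unit using (tt)
import Data.Vec as Vec
open import Data.Vec.Properties using (lookup∘tabulate; lookup-replicate; []=⇒lookup; lookup⇒[]=)
open import Function using (_∘_; id)
open import Function.Bundles using (Equivalence)
open import Induction.WellFounded using (Acc; acc)
open import Relation.Binary using (Rel; Symmetric)
open import Relation.Binary.Definitions using (tri<; tri≈; tri>) renaming (Decidable to Decidable₂)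
open import Relation.Binary.PropositionalEquality
open import Relation.Nullary using (¬_; Dec; yes; no; does)
open import Relation.Nullary.Decidable
  using (_×-dec_; _⊎-dec_; ¬?; decidable-stable; toSum; map′; T?; dec-true; dec-false)
open import Relation.Unary using (Pred; Decidable; _⊆_; _≐_; _∩_; _∪_; _∖_; ∁)
open import Relation.Unary.Properties using (U?; _∩?_; _∪?_; ∁?)

𝟙 : {A : Set} → Dec A → ℕ
𝟙 a? = if does a? then 1 else 0

record Splits (A B C : Set) : Set where
  field
    split    : A → B ⊎ C
    fromˡ    : B → A
    fromʳ    : C → A
    disjoint : B → C → ⊥

Splits-under : {E A B C : Set} → (E → Splits A B C) → Splits (E × A) (E × B) (E × C)
Splits-under s = record
  { split    = λ (e , a) → map-⊎ (e ,_) (e ,_) (Splits.split (s e) a)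
  ; fromˡ    = λ (e , b) → e , Splits.fromˡ (s e) b
  ; fromʳ    = λ (e , c) → e , Splits.fromʳ (s e) c
  ; disjoint = λ (e , b) (_ , c) → Splits.disjoint (s e) b c
  }

𝟙-split : {A B C : Set} (a? : Dec A) (b? : Dec B) (c? : Dec C) → Splits A B C → 𝟙 a? ≡ 𝟙 b? + 𝟙 c?
𝟙-split (yes a) (yes b) (yes c) s = ⊥-elim (Splits.disjoint s b c)
𝟙-split (yes a) (yes b) (no _)  s = refl
𝟙-split (yes a) (no _)  (yes c) s = refl
𝟙-split (yes a) (no ¬b) (no ¬c) s = ⊥-elim ([ ¬b , ¬c ]′ (Splits.split s a))
𝟙-split (no ¬a) (yes b) _       s = ⊥-elim (¬a (Splits.fromˡ s b))
𝟙-split (no ¬a) (no _)  (yes c) s = ⊥-elim (¬a (Splits.fromʳ s c))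
𝟙-split (no _)  (no _)  (no _)  s = refl

𝟙-no : {A : Set} (a? : Dec A) → ¬ A → 𝟙 a? ≡ 0
𝟙-no (yes a) ¬a = ⊥-elim (¬a a)
𝟙-no (no _)  _  = refl

𝟙-mono : {A B : Set} → (A → B) → (a? : Dec A) (b? : Dec B) → 𝟙 a? ≤ 𝟙 b?
𝟙-mono f (yes a) (yes _) = ≤-refl
𝟙-mono f (yes a) (no ¬b) = ⊥-elim (¬b (f a))
𝟙-mono f (no _)  _       = z≤n

∑-mono-≤ : ∀ {n} {f g : Fin n → ℕ} → (∀ i → f i ≤ g i) → sum f ≤ sum g
∑-mono-≤ {zero}  _   = z≤n
∑-mono-≤ {suc n} f≤g = +-mono-≤ (f≤g zero) (∑-mono-≤ (f≤g ∘ suc))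

∑-term-≤ : ∀ {n} (f : Fin n → ℕ) i → f i ≤ sum f
∑-term-≤ f zero    = m≤m+n _ _
∑-term-≤ f (suc i) = ≤-trans (∑-term-≤ (f ∘ suc) i) (m≤n+m _ _)

∑-only : ∀ {n} (f : Fin n → ℕ) a → (∀ i → i ≢ a → f i ≡ 0) → sum f ≡ f a
∑-only {suc n} f zero f≡0 =
  trans (cong (f zero +_) (trans (sum-cong-≗ (λ i → f≡0 (suc i) λ ())) (sum-replicate-zero n))) (+-identityʳ _)
∑-only {suc n} f (suc a) f≡0 =
  trans (cong (_+ sum (f ∘ suc)) (f≡0 zero λ ())) (∑-only (f ∘ suc) a λ i i≢a → f≡0 (suc i) (i≢a ∘ suc-injective))

card : ∀ {n} {P : Pred (Fin n) 0ℓ} → Decidable P → ℕ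
card {n} P? = ∑[ i < n ] 𝟙 (P? i)

module _ {n} {P Q : Pred (Fin n) 0ℓ} (P? : Decidable P) (Q? : Decidable Q) where

  card-split : ∀ {R} (R? : Decidable R) → (∀ i → Splits (R i) (P i) (Q i)) → card R? ≡ card P? + card Q?
  card-split R? s =
    trans (sum-cong-≗ (λ i → 𝟙-split (R? i) (P? i) (Q? i) (s i))) (∑-distrib-+ (𝟙 ∘ P?) (𝟙 ∘ Q?))

  card-∪ : (∀ {x} → P x → Q x → ⊥) → card (P? ∪? Q?) ≡ card P? + card Q?
  card-∪ disjoint = card-split (P? ∪? Q?) λ _ → record
    { split = id ; fromˡ = inj₁ ; fromʳ = inj₂ ; disjoint = disjoint }

  card-mono : P ⊆ Q → card P? ≤ card Q?
  card-mono P⊆Q = ∑-mono-≤ λ i → 𝟙-mono P⊆Q (P? i) (Q? i)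

card-cong : ∀ {n} {P Q : Pred (Fin n) 0ℓ} (P? : Decidable P) (Q? : Decidable Q) → P ≐ Q → card P? ≡ card Q?
card-cong P? Q? (P⊆Q , Q⊆P) = ≤-antisym (card-mono P? Q? P⊆Q) (card-mono Q? P? Q⊆P)

card-pos : ∀ {n} {P : Pred (Fin n) 0ℓ} (P? : Decidable P) {a} → P a → 0 < card P?
card-pos P? {a} pa = ≤-trans (𝟙-mono (λ _ → pa) (yes tt) (P? a)) (∑-term-≤ (𝟙 ∘ P?) a)

card-U : ∀ n → card {n} U? ≡ n
card-U zero    = refl
card-U (suc n) = cong suc (card-U n)

card-singleton : ∀ {n} (a : Fin n) → card (_≟ a) ≡ 1
card-singleton {suc n} zero    = cong suc (sum-replicate-zero n)
card-singleton {suc n} (suc a) = card-singleton a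

infixl 6 _─_ _─?_

_─_ : ∀ {n} → Pred (Fin n) 0ℓ → Fin n → Pred (Fin n) 0ℓ
P ─ a = P ∩ (_≢ a)

_─?_ : ∀ {n} {P : Pred (Fin n) 0ℓ} → Decidable P → ∀ a → Decidable (P ─ a)
(P? ─? a) x = P? x ×-dec ¬? (x ≟ a)

card-─ : ∀ {n} {P : Pred (Fin n) 0ℓ} (P? : Decidable P) {a} → P a → card P? ≡ card (P? ─? a) + 1
card-─ P? {a} pa = trans (card-split (P? ─? a) (_≟ a) P? λ x → record
    { split    = λ px → [ inj₂ , (λ x≢a → inj₁ (px , x≢a)) ]′ (toSum (x ≟ a))
    ; fromˡ    = proj₁
    ; fromʳ    = λ { refl → pa }
    ; disjoint = λ (_ , x≢a) x≡a → x≢a x≡a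
    })
  (cong (card (P? ─? a) +_) (card-singleton a))

Pair : ∀ {n} → Fin n → Fin n → Pred (Fin n) 0ℓ
Pair u w v = v ≡ u ⊎ v ≡ w

pair? : ∀ {n} (u w : Fin n) → Decidable (Pair u w)
pair? u w v = (v ≟ u) ⊎-dec (v ≟ w)

Away : ∀ {n} → Fin n → Fin n → Pred (Fin n) 0ℓ
Away u w v = v ≢ u × v ≢ w

away? : ∀ {n} (u w : Fin n) → Decidable (Away u w)
away? u w v = ¬? (v ≟ u) ×-dec ¬? (v ≟ w)

pair-other : ∀ {n} {u w p q a : Fin n} → Pair u w p → Pair u w q → p ≢ q → Pair u w a → a ≢ p → a ≡ q
pair-other (inj₁ refl) (inj₁ refl) p≢q _ _ = ⊥-elim (p≢q refl)
pair-other (inj₂ refl) (inj₂ refl) p≢q _ _ = ⊥-elim (p≢q refl)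
pair-other (inj₁ refl) (inj₂ refl) _ (inj₁ refl) a≢p = ⊥-elim (a≢p refl)
pair-other (inj₁ refl) (inj₂ refl) _ (inj₂ refl) _   = refl
pair-other (inj₂ refl) (inj₁ refl) _ (inj₁ refl) _   = refl
pair-other (inj₂ refl) (inj₁ refl) _ (inj₂ refl) a≢p = ⊥-elim (a≢p refl)

card-pair : ∀ {n} {u w : Fin n} → u ≢ w → card (pair? u w) ≡ 2
card-pair {u = u} {w} u≢w =
  trans (card-∪ (_≟ u) (_≟ w) λ { refl refl → u≢w refl }) (cong₂ _+_ (card-singleton u) (card-singleton w))

two-elements : ∀ {n} {a b : Fin n} → a ≢ b → (∀ j → Pair a b j) → n ≡ 2
two-elements {n} {a} {b} a≢b every =
  trans (sym (card-U n)) (trans (card-cong U? (pair? a b) ((λ {j} _ → every j) , _)) (card-pair a≢b))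

module _ {V : Set} {_~_ : Rel V 0ℓ} where

  reach-start : ∀ {P : Pred V 0ℓ} {a b} → Reach _~_ P a b → P a
  reach-start (here pa)     = pa
  reach-start (step pa _ _) = pa

  reach-end : ∀ {P : Pred V 0ℓ} {a b} → Reach _~_ P a b → P b
  reach-end (here pa)    = pa
  reach-end (step _ _ r) = reach-end r

  reach-map : ∀ {P Q : Pred V 0ℓ} → P ⊆ Q → ∀ {a b} → Reach _~_ P a b → Reach _~_ Q a b
  reach-map P⊆Q (here pa)     = here (P⊆Q pa)
  reach-map P⊆Q (step pa e r) = step (P⊆Q pa) e (reach-map P⊆Q r)

  reach-++ : ∀ {P : Pred V 0ℓ} {a b c} → Reach _~_ P a b → Reach _~_ P b c → Reach _~_ P a c
  reach-++ (here _)      r′ = r′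
  reach-++ (step pa e r) r′ = step pa e (reach-++ r r′)

  reach-snoc : ∀ {P : Pred V 0ℓ} {a b c} → Reach _~_ P a b → b ~ c → P c → Reach _~_ P a c
  reach-snoc r e pc = reach-++ r (step (reach-end r) e (here pc))

  reach-within : ∀ {P C : Pred V 0ℓ} → (∀ {c d} → C c → P d → c ~ d → C d) →
                 ∀ {a b} → C a → Reach _~_ P a b → Reach _~_ (P ∩ C) a b
  reach-within closed ca (here pa)     = here (pa , ca)
  reach-within closed ca (step pa e r) = step (pa , ca) e (reach-within closed (closed ca (reach-start r) e) r)

  reach-exit : ∀ {P Q : Pred V 0ℓ} → Decidable Q → ∀ {a b} → Reach _~_ P a b → Q a → ¬ Q b →
               ∃₂ λ x y → Reach _~_ (P ∩ Q) a x × x ~ y × P y × ¬ Q y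
  reach-exit Q? (here pa)             qa ¬qb = ⊥-elim (¬qb qa)
  reach-exit Q? (step {y = y} pa e r) qa ¬qb with Q? y
  ... | no ¬qy = _ , y , here (pa , qa) , e , reach-start r , ¬qy
  ... | yes qy with reach-exit Q? r qy ¬qb
  ...   | x , z , r′ , e′ , pz , ¬qz = x , z , step (pa , qa) e r′ , e′ , pz , ¬qz

  module _ (~-sym : Symmetric _~_) where

    reach-reverse : ∀ {P : Pred V 0ℓ} {a b} → Reach _~_ P a b → Reach _~_ P b a
    reach-reverse (here pa)     = here pa
    reach-reverse (step pa e r) = reach-snoc (reach-reverse r) (~-sym e) pa

    connected-via : ∀ {P : Pred V 0ℓ} {h} → P h → (∀ {y} → P y → Reach _~_ P y h) → Connected _~_ P
    connected-via ph to-h = (_ , ph) , λ a b pa pb → reach-++ (to-h pa) (reach-reverse (to-h pb))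

  connected-≐ : ∀ {P Q : Pred V 0ℓ} → P ≐ Q → Connected _~_ P → Connected _~_ Q
  connected-≐ (P⊆Q , Q⊆P) ((x , px) , conn) =
    (x , P⊆Q px) , λ a b qa qb → reach-map P⊆Q (conn a b (Q⊆P qa) (Q⊆P qb))

  2-connected-≐ : ∀ {P Q : Pred V 0ℓ} → P ≐ Q → TwoConnected _~_ P → TwoConnected _~_ Q
  2-connected-≐ (P⊆Q , Q⊆P) ((x , y , px , py , x≢y) , conn , no-cut) =
    (x , y , P⊆Q px , P⊆Q py , x≢y) , connected-≐ (P⊆Q , Q⊆P) conn ,
    λ z qz → connected-≐ ((λ (p , ≢z) → P⊆Q p , ≢z) , (λ (q , ≢z) → Q⊆P q , ≢z)) (no-cut z (Q⊆P qz))

module _ {n} {_~_ : Rel (Fin n) 0ℓ} (_~?_ : Decidable₂ _~_) where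

  reach-last-visit : ∀ {P : Pred (Fin n) 0ℓ} {a b c} → Reach _~_ P c b → b ≢ a →
                     Reach _~_ (P ─ a) c b ⊎ ∃ λ z → a ~ z × Reach _~_ (P ─ a) z b
  reach-last-visit (here pb) b≢a = inj₁ (here (pb , b≢a))
  reach-last-visit {a = a} (step {x = c} {y} pc e r) b≢a with reach-last-visit r b≢a
  ... | inj₂ via = inj₂ via
  ... | inj₁ r′ with c ≟ a
  ...   | yes refl = inj₂ (y , e , r′)
  ...   | no c≢a   = inj₁ (step (pc , c≢a) e r′)

  reach? : ∀ {P : Pred (Fin n) 0ℓ} → Decidable P → ∀ a b → Dec (Reach _~_ P a b)
  reach? P? = go P? (<-wellFounded (card P?))
    where
    shrinks : ∀ {P : Pred (Fin n) 0ℓ} (P? : Decidable P) {a} → P a → card (P? ─? a) < card P?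
    shrinks P? pa = ≤-trans (m<m+n _ (s≤s z≤n)) (≤-reflexive (sym (card-─ P? pa)))

    go : ∀ {P : Pred (Fin n) 0ℓ} (P? : Decidable P) → Acc _<_ (card P?) → ∀ a b → Dec (Reach _~_ P a b)
    go P? (acc smaller) a b with P? a | a ≟ b
    ... | no ¬pa | _        = no (¬pa ∘ reach-start)
    ... | yes pa | yes refl = yes (here pa)
    ... | yes pa | no a≢b
      with any? (λ z → (a ~? z) ×-dec go (P? ─? a) (smaller (shrinks P? pa)) z b)
    ...   | yes (z , e , r) = yes (step pa e (reach-map proj₁ r))
    ...   | no ¬via         = no λ r →
            [ (λ r′ → proj₂ (reach-start r′) refl) , ¬via ]′ (reach-last-visit r (a≢b ∘ sym))

toSubset : ∀ {n} {P : Pred (Fin n) 0ℓ} → Decidable P → Subset n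
toSubset P? = Vec.tabulate (does ∘ P?)

module _ {n} {P : Pred (Fin n) 0ℓ} (P? : Decidable P) where

  lookup-toSubset : ∀ i → Vec.lookup (toSubset P?) i ≡ does (P? i)
  lookup-toSubset = lookup∘tabulate (does ∘ P?)

  ∈-toSubset⁺ : ∀ {i} → P i → i Subset.∈ toSubset P?
  ∈-toSubset⁺ {i} pi = lookup⇒[]= i (toSubset P?) (trans (lookup-toSubset i) (dec-true (P? i) pi))

  ∈-toSubset⁻ : ∀ {i} → i Subset.∈ toSubset P? → P i
  ∈-toSubset⁻ {i} i∈ = decidable-stable (P? i) λ ¬pi →
    case (trans (sym ([]=⇒lookup i∈)) (trans (lookup-toSubset i) (dec-false (P? i) ¬pi)))
    where
    case : true ≢ false
    case ()

∣toSubset∣ : ∀ {n} {P : Pred (Fin n) 0ℓ} (P? : Decidable P) → Subset.∣ toSubset P? ∣ ≡ card P?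
∣toSubset∣ {zero}  P? = refl
∣toSubset∣ {suc n} P? with does (P? zero)
... | true  = cong suc (∣toSubset∣ (P? ∘ suc))
... | false = ∣toSubset∣ (P? ∘ suc)

∑-allFin : ∀ {n} (f : Fin n → ℕ) → List.sum (List.map f (List.allFin n)) ≡ ∑[ i < n ] f i
∑-allFin f = trans (cong List.sum (map-tabulate id f)) (go f)
  where
  go : ∀ {m} (g : Fin m → ℕ) → List.sum (List.tabulate g) ≡ ∑[ i < m ] g i
  go {zero}  g = refl
  go {suc m} g = cong (g zero +_) (go (g ∘ suc))

∧-shuffle : ∀ a b c d → a ∧ (b ∧ (c ∧ d)) ≡ (a ∧ d) ∧ (b ∧ c)
∧-shuffle false _     _     _ = refl
∧-shuffle true  false _     d = sym (∧-zeroʳ d)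
∧-shuffle true  true  false d = sym (∧-zeroʳ d)
∧-shuffle true  true  true  d = sym (∧-identityʳ d)

module _ (G : Graph) where
  open Graph G renaming (sym to adj-sym)

  infix 4 _~_ _~?_

  _~_ : Rel (Fin N) 0ℓ
  _~_ = Adj G

  _~?_ : Decidable₂ _~_
  x ~? y = map′ (Equivalence.to T-≡) (Equivalence.from T-≡) (T? (adj x y))

  ~-sym : Symmetric _~_
  ~-sym {x} {y} e = trans (adj-sym y x) e

  ~-irrefl : ∀ {x} → ¬ x ~ x
  ~-irrefl {x} e with () ← trans (sym e) (irrefl x)

  Walk : Pred (Fin N) 0ℓ → Fin N → Fin N → Set
  Walk = Reach _~_

  Edge : Rel (Fin N) 0ℓ
  Edge i j = toℕ i < toℕ j × i ~ j

  edge? : Decidable₂ Edge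
  edge? i j = (toℕ i <? toℕ j) ×-dec (i ~? j)

  edges : {Q : Rel (Fin N) 0ℓ} → Decidable₂ Q → ℕ
  edges Q? = ∑[ i < N ] ∑[ j < N ] 𝟙 (edge? i j ×-dec Q? i j)

  edges-mono : {Q Q′ : Rel (Fin N) 0ℓ} (Q? : Decidable₂ Q) (Q′? : Decidable₂ Q′) →
               (∀ {i j} → Edge i j → Q i j → Q′ i j) → edges Q? ≤ edges Q′?
  edges-mono Q? Q′? Q⇒Q′ = ∑-mono-≤ λ i → ∑-mono-≤ λ j →
    𝟙-mono (λ (e , q) → e , Q⇒Q′ e q) (edge? i j ×-dec Q? i j) (edge? i j ×-dec Q′? i j)

  edges-pos : {Q : Rel (Fin N) 0ℓ} (Q? : Decidable₂ Q) → ∀ {i j} → Edge i j → Q i j → 0 < edges Q?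
  edges-pos Q? {i} {j} e q =
    ≤-trans (𝟙-mono (λ _ → e , q) (yes tt) (edge? i j ×-dec Q? i j))
      (≤-trans (∑-term-≤ _ j) (∑-term-≤ (λ i → ∑[ j < N ] 𝟙 (edge? i j ×-dec Q? i j)) i))

  edges-none : {Q : Rel (Fin N) 0ℓ} (Q? : Decidable₂ Q) → (∀ {i j} → Edge i j → ¬ Q i j) → edges Q? ≡ 0
  edges-none Q? none = n≤0⇒n≡0 (≤-trans
    (∑-mono-≤ λ i → ∑-mono-≤ λ j → 𝟙-mono {B = ⊥} (λ (e , q) → none e q) (edge? i j ×-dec Q? i j) (no id))
    (≤-reflexive (trans (sum-cong-≗ {N} λ _ → sum-replicate-zero N) (sum-replicate-zero N))))

  edges-split : {Q Q₁ Q₂ : Rel (Fin N) 0ℓ} (Q? : Decidable₂ Q) (Q₁? : Decidable₂ Q₁) (Q₂? : Decidable₂ Q₂) →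
                (∀ {i j} → Edge i j → Splits (Q i j) (Q₁ i j) (Q₂ i j)) → edges Q? ≡ edges Q₁? + edges Q₂?
  edges-split Q? Q₁? Q₂? s = begin
    edges Q?
      ≡⟨ sum-cong-≗ (λ i → trans (sum-cong-≗ λ j → 𝟙-split (term Q? i j) (term Q₁? i j) (term Q₂? i j)
                                                             (Splits-under s))
                                 (∑-distrib-+ (𝟙 ∘ term Q₁? i) (𝟙 ∘ term Q₂? i))) ⟩
    ∑[ i < N ] (∑[ j < N ] 𝟙 (term Q₁? i j) + ∑[ j < N ] 𝟙 (term Q₂? i j))
      ≡⟨ ∑-distrib-+ (λ i → ∑[ j < N ] 𝟙 (term Q₁? i j)) (λ i → ∑[ j < N ] 𝟙 (term Q₂? i j)) ⟩
    edges Q₁? + edges Q₂? ∎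
    where
    open ≡-Reasoning
    term : ∀ {Q : Rel (Fin N) 0ℓ} → Decidable₂ Q → Decidable₂ (λ i j → Edge i j × Q i j)
    term Q? i j = edge? i j ×-dec Q? i j

  both? : {X : Pred (Fin N) 0ℓ} → Decidable X → Decidable₂ (λ i j → X i × X j)
  both? X? i j = X? i ×-dec X? j

  either? : {Z : Pred (Fin N) 0ℓ} → Decidable Z → Decidable₂ (λ i j → Z i ⊎ Z j)
  either? Z? i j = Z? i ⊎-dec Z? j

  edgesWithin : {X : Pred (Fin N) 0ℓ} → Decidable X → ℕ
  edgesWithin X? = edges (both? X?)

  edgesMeeting : {Z : Pred (Fin N) 0ℓ} → Decidable Z → ℕ
  edgesMeeting Z? = edges (either? Z?)

  edgesWithin-∪ : ∀ {X Y Z : Pred (Fin N) 0ℓ} (X? : Decidable X) (Y? : Decidable Y) (Z? : Decidable Z) →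
                  X ⊆ Y ∪ Z → Y ⊆ X → Z ⊆ X → (∀ {a b} → (Y ∩ Z) a → (Y ∩ Z) b → a ≡ b) →
                  (∀ {a b} → Y a → Z b → a ~ b → Z a ⊎ Y b) →
                  edgesWithin X? ≡ edgesWithin Y? + edgesWithin Z?
  edgesWithin-∪ {Y = Y} {Z} X? Y? Z? X⊆Y∪Z Y⊆X Z⊆X shared crossing =
    edges-split (both? X?) (both? Y?) (both? Z?) λ (_ , e) → record
      { split    = λ (xi , xj) → side (X⊆Y∪Z xi) (X⊆Y∪Z xj) e
      ; fromˡ    = λ (yi , yj) → Y⊆X yi , Y⊆X yj
      ; fromʳ    = λ (zi , zj) → Z⊆X zi , Z⊆X zj
      ; disjoint = λ (yi , yj) (zi , zj) → ~-irrefl (subst (_~ _) (shared (yi , zi) (yj , zj)) e)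
      }
    where
    side : ∀ {i j} → (Y ∪ Z) i → (Y ∪ Z) j → i ~ j → (Y i × Y j) ⊎ (Z i × Z j)
    side (inj₁ yi) (inj₁ yj) _ = inj₁ (yi , yj)
    side (inj₂ zi) (inj₂ zj) _ = inj₂ (zi , zj)
    side (inj₁ yi) (inj₂ zj) e = [ (λ zi → inj₂ (zi , zj)) , (λ yj → inj₁ (yi , yj)) ]′ (crossing yi zj e)
    side (inj₂ zi) (inj₁ yj) e = [ (λ zj → inj₂ (zi , zj)) , (λ yi → inj₁ (yi , yj)) ]′ (crossing yj zi (~-sym e))

  module _ {X Z : Pred (Fin N) 0ℓ} (X? : Decidable X) (Z? : Decidable Z)
           (X⇒∉Z : ∀ {v} → X v → ¬ Z v) (∉Z⇒X : ∀ {v} → ¬ Z v → X v) where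

    edges-complement : edgesWithin U? ≡ edgesWithin X? + edgesMeeting Z?
    edges-complement = edges-split (both? U?) (both? X?) (either? Z?)
      λ {i} {j} _ → record
        { split    = λ _ → side (Z? i) (Z? j)
        ; fromˡ    = λ _ → tt , tt
        ; fromʳ    = λ _ → tt , tt
        ; disjoint = λ (xi , xj) → [ X⇒∉Z xi , X⇒∉Z xj ]′
        }
      where
      side : ∀ {i j} → Dec (Z i) → Dec (Z j) → (X i × X j) ⊎ (Z i ⊎ Z j)
      side (yes zi) _        = inj₂ (inj₁ zi)
      side (no _)   (yes zj) = inj₂ (inj₂ zj)
      side (no ¬zi) (no ¬zj) = inj₁ (∉Z⇒X ¬zi , ∉Z⇒X ¬zj)

    card-complement : N ≡ card X? + card Z?
    card-complement = trans (sym (card-U N)) (card-split X? Z? U? λ v → record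
      { split    = λ _ → [ inj₂ , inj₁ ∘ ∉Z⇒X ]′ (toSum (Z? v))
      ; fromˡ    = λ _ → tt
      ; fromʳ    = λ _ → tt
      ; disjoint = X⇒∉Z
      })

  edges-between : ∀ u w → edges (λ i j → (i ≟ u) ×-dec (j ≟ w)) ≡ 𝟙 (edge? u w)
  edges-between u w = begin
    edges (λ i j → (i ≟ u) ×-dec (j ≟ w))
      ≡⟨ ∑-only _ u (λ i i≢u → trans (sum-cong-≗ λ j → 𝟙-no (term i j) (i≢u ∘ proj₁ ∘ proj₂))
                                     (sum-replicate-zero N)) ⟩
    ∑[ j < N ] 𝟙 (term u j)
      ≡⟨ ∑-only _ w (λ j j≢w → 𝟙-no (term u j) (j≢w ∘ proj₂ ∘ proj₂)) ⟩
    𝟙 (term u w)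
      ≡⟨ ≤-antisym (𝟙-mono proj₁ (term u w) (edge? u w)) (𝟙-mono (_, refl , refl) (edge? u w) (term u w)) ⟩
    𝟙 (edge? u w) ∎
    where
    open ≡-Reasoning
    term : ∀ i j → Dec (Edge i j × i ≡ u × j ≡ w)
    term i j = edge? i j ×-dec ((i ≟ u) ×-dec (j ≟ w))

  edgesWithin-pair≤1 : ∀ {u w} → u ≢ w → edgesWithin (pair? u w) ≤ 1
  edgesWithin-pair≤1 {u} {w} u≢w = begin
    edgesWithin (pair? u w)
      ≤⟨ edges-mono (both? (pair? u w)) Q? ordered ⟩
    edges Q?
      ≡⟨ edges-split Q? (λ i j → (i ≟ u) ×-dec (j ≟ w)) (λ i j → (i ≟ w) ×-dec (j ≟ u)) (λ _ → record
           { split = id ; fromˡ = inj₁ ; fromʳ = inj₂ ; disjoint = λ { (refl , _) (refl , _) → u≢w refl } }) ⟩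
    edges (λ i j → (i ≟ u) ×-dec (j ≟ w)) + edges (λ i j → (i ≟ w) ×-dec (j ≟ u))
      ≡⟨ cong₂ _+_ (edges-between u w) (edges-between w u) ⟩
    𝟙 (edge? u w) + 𝟙 (edge? w u)
      ≤⟨ one-direction (edge? u w) (edge? w u) ⟩
    1 ∎
    where
    open ≤-Reasoning
    Q? : ∀ i j → Dec ((i ≡ u × j ≡ w) ⊎ (i ≡ w × j ≡ u))
    Q? i j = ((i ≟ u) ×-dec (j ≟ w)) ⊎-dec ((i ≟ w) ×-dec (j ≟ u))
    ordered : ∀ {i j} → Edge i j → Pair u w i × Pair u w j → (i ≡ u × j ≡ w) ⊎ (i ≡ w × j ≡ u)
    ordered (_ , e) (inj₁ refl , inj₁ refl) = ⊥-elim (~-irrefl e)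
    ordered (_ , e) (inj₁ refl , inj₂ refl) = inj₁ (refl , refl)
    ordered (_ , e) (inj₂ refl , inj₁ refl) = inj₂ (refl , refl)
    ordered (_ , e) (inj₂ refl , inj₂ refl) = ⊥-elim (~-irrefl e)
    one-direction : (a? : Dec (Edge u w)) (b? : Dec (Edge w u)) → 𝟙 a? + 𝟙 b? ≤ 1
    one-direction (yes (u<w , _)) (yes (w<u , _)) = ⊥-elim (<-asym u<w w<u)
    one-direction (yes _) (no _)  = ≤-refl
    one-direction (no _)  (yes _) = ≤-refl
    one-direction (no _)  (no _)  = z≤n

  edgesWithin-pair-pos : ∀ {u w} → u ~ w → 0 < edgesWithin (pair? u w)
  edgesWithin-pair-pos {u} {w} e with <-cmp (toℕ u) (toℕ w)
  ... | tri< u<w _ _ = edges-pos (both? (pair? u w)) (u<w , e) (inj₁ refl , inj₂ refl)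
  ... | tri≈ _ u≡w _ = ⊥-elim (~-irrefl (subst (u ~_) (sym (toℕ-injective u≡w)) e))
  ... | tri> _ _ w<u = edges-pos (both? (pair? u w)) (w<u , ~-sym e) (inj₂ refl , inj₁ refl)

  edgesIn≡edgesWithin : (S : Subset N) {X : Pred (Fin N) 0ℓ} (X? : Decidable X) →
                        (∀ i → Vec.lookup S i ≡ does (X? i)) → edgesIn G S ≡ edgesWithin X?
  edgesIn≡edgesWithin S X? S≗X = begin
    edgesIn G S
      ≡⟨ ∑-allFin (λ i → List.sum (List.map (term i) (List.allFin N))) ⟩
    ∑[ i < N ] List.sum (List.map (term i) (List.allFin N))
      ≡⟨ sum-cong-≗ (λ i → trans (∑-allFin (term i)) (sum-cong-≗ λ j → cong (if_then 1 else 0) (term≡ i j))) ⟩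
    edgesWithin X? ∎
    where
    open ≡-Reasoning
    term : Fin N → Fin N → ℕ
    term i j = if (toℕ i <ᵇ toℕ j) ∧ Vec.lookup S i ∧ Vec.lookup S j ∧ adj i j then 1 else 0
    term≡ : ∀ i j → (toℕ i <ᵇ toℕ j) ∧ Vec.lookup S i ∧ Vec.lookup S j ∧ adj i j ≡
                    does (edge? i j ×-dec both? X? i j)
    term≡ i j = trans (cong₂ (λ x y → (toℕ i <ᵇ toℕ j) ∧ (x ∧ (y ∧ adj i j))) (S≗X i) (S≗X j))
                      (∧-shuffle (toℕ i <ᵇ toℕ j) (does (X? i)) (does (X? j)) (adj i j))

  module Contraction {X : Pred (Fin N) 0ℓ} (X? : Decidable X) where

    S : Subset N
    S = toSubset X?

    _≈_ : Rel (Maybe (Fin N)) 0ℓ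
    _≈_ = ContrAdj G S

    ≈-sym : Symmetric _≈_
    ≈-sym {just x}  {just y}  e            = ~-sym e
    ≈-sym {just x}  {nothing} (v , v∈ , e) = v , v∈ , ~-sym e
    ≈-sym {nothing} {just y}  (v , v∈ , e) = v , v∈ , ~-sym e

    lift : ∀ {P : Pred (Fin N) 0ℓ} {Q : Pred (Maybe (Fin N)) 0ℓ} → (∀ {v} → P v → Q (just v)) →
           ∀ {a b} → Walk P a b → Reach _≈_ Q (just a) (just b)
    lift P⇒Q (here pa)     = here (P⇒Q pa)
    lift P⇒Q (step pa e r) = step (P⇒Q pa) e (lift P⇒Q r)

    outside : ∀ {v} → ¬ X v → v Subset.∉ S
    outside ¬xv = ¬xv ∘ ∈-toSubset⁻ X?

    not-inside : ∀ {v} → v Subset.∉ S → ¬ X v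
    not-inside v∉ xv = v∉ (∈-toSubset⁺ X? xv)

    to-hub : ∀ {P : Pred (Fin N) 0ℓ} {Q : Pred (Maybe (Fin N)) 0ℓ} → Q nothing →
             (∀ {v} → P v → ¬ X v → Q (just v)) →
             ∀ {z a} → X a → ¬ X z → Walk P z a → Reach _≈_ Q (just z) nothing
    to-hub qn P⇒Q xa ¬xz r with reach-exit (∁? X?) r ¬xz (λ ¬xa → ¬xa xa)
    ... | x , y , r′ , e , _ , ¬¬xy =
      reach-snoc (lift (λ (pv , ¬xv) → P⇒Q pv ¬xv) r′) (y , ∈-toSubset⁺ X? (decidable-stable (X? y) ¬¬xy) , e) qn

    contraction-2-connected : TwoConnected _~_ (All G) → ∀ {a r} → X a → ¬ X r →
                              (∀ {a b} → ¬ X a → ¬ X b → Walk (∁ X) a b) →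
                              TwoConnected _≈_ (ContrV G S)
    contraction-2-connected (_ , (_ , conn) , no-cut) {a} {r} xa ¬xr conn-out =
      (nothing , just r , tt , outside ¬xr , λ ()) ,
      connected-via ≈-sym tt (λ { {nothing} _ → here tt
                                ; {just z} z∉ → to-hub tt (λ _ → outside) xa (not-inside z∉) (conn z a tt tt) }) ,
      λ { nothing _ → (just r , outside ¬xr , λ ()) , λ
            { (just a′) (just b′) (a∉ , _) (b∉ , _) →
                lift (λ ¬xv → outside ¬xv , λ ()) (conn-out (not-inside a∉) (not-inside b∉))
            ; nothing _ (_ , ≢n) _ → ⊥-elim (≢n refl)
            ; (just _) nothing _ (_ , ≢n) → ⊥-elim (≢n refl) }
        ; (just c) c∉ → connected-via ≈-sym (tt , λ ())
            λ { {nothing} _ → here (tt , λ ())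
              ; {just z} (z∉ , z≢c) →
                  to-hub (tt , λ ()) (λ (_ , v≢c) ¬xv → outside ¬xv , λ { refl → v≢c refl }) xa (not-inside z∉)
                    (proj₂ (no-cut c tt) z a (tt , z≢c ∘ cong just) (tt , λ { refl → not-inside c∉ xa })) } }

  module ♠₂ (2-conn : TwoConnected _~_ (All G)) (spade : Spade2 G) where

    edgesWithin-U : edgesWithin U? ≡ 2 * (N ∸ 1)
    edgesWithin-U = trans (sym (edgesIn≡edgesWithin Subset.⊤ U? (λ i → lookup-replicate i true))) (proj₁ spade)

    edges-total : ∀ {m} → N ≡ suc m → edgesWithin U? ≡ 2 * m
    edges-total refl = edgesWithin-U

    flat-edges : ∀ {X : Pred (Fin N) 0ℓ} (X? : Decidable X) → TwoConnected _~_ X → ∀ {a r} → X a → ¬ X r →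
                 (∀ {a b} → ¬ X a → ¬ X b → Walk (∁ X) a b) → edgesWithin X? + 3 ≡ 2 * card X?
    flat-edges X? 2-conn-X xa ¬xr conn-out =
      subst₂ (λ e c → e + 3 ≡ 2 * c) (edgesIn≡edgesWithin S X? (lookup-toSubset X?)) (∣toSubset∣ X?)
        (proj₂ spade S (2-connected-≐ (∈-toSubset⁺ X? , ∈-toSubset⁻ X?) 2-conn-X ,
                        contraction-2-connected 2-conn xa ¬xr conn-out))
      where open Contraction X?

    walk-avoiding : ∀ {c a b} → a ≢ c → b ≢ c → Walk (_≢ c) a b
    walk-avoiding {c} a≢c b≢c = reach-map proj₂ (proj₂ (proj₂ (proj₂ 2-conn) c tt) _ _ (tt , a≢c) (tt , b≢c))

    record Lobe (u w : Fin N) (K : Pred (Fin N) 0ℓ) : Set where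
      field
        ends-distinct   : u ≢ w
        avoids-ends     : ∀ {v} → K v → ¬ Pair u w v
        outer-point     : ∃ (∁ (K ∪ Pair u w))
        outer-connected : ∀ {a b} → ¬ (K ∪ Pair u w) a → ¬ (K ∪ Pair u w) b → Walk (∁ (K ∪ Pair u w)) a b
        no-outer-edge   : ∀ {a b} → K a → ¬ (K ∪ Pair u w) b → ¬ a ~ b

    LobeOutcome : (u w : Fin N) {K : Pred (Fin N) 0ℓ} → Decidable K → Set
    LobeOutcome u w {K} K? = (TwoConnected _~_ (K ∪ Pair u w) × edgesWithin (K? ∪? pair? u w) ≡ 2 * card K? + 1)
                           ⊎ edgesWithin (K? ∪? pair? u w) ≤ 2 * card K?

    lobe-outcome-bound : ∀ {u w K} (K? : Decidable K) → LobeOutcome u w K? →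
                         edgesWithin (K? ∪? pair? u w) ≤ 2 * card K? + 1
    lobe-outcome-bound _ = [ ≤-reflexive ∘ proj₂ , (λ le → ≤-trans le (m≤m+n _ 1)) ]′

    LobesBelow : ℕ → Set₁
    LobesBelow m = ∀ {p c P} (P? : Decidable P) → Lobe p c P → card P? < m →
                   edgesWithin (P? ∪? pair? p c) ≤ 2 * card P? + 1

    module LobeFacts {u w : Fin N} {K : Pred (Fin N) 0ℓ} (K? : Decidable K) (lobe : Lobe u w K) where
      open Lobe lobe

      X : Pred (Fin N) 0ℓ
      X = K ∪ Pair u w

      X? : Decidable X
      X? = K? ∪? pair? u w

      u∈X : X u
      u∈X = inj₂ (inj₁ refl)

      w∈X : X w
      w∈X = inj₂ (inj₂ refl)

      escape : ∀ {c y} → X c → (X ─ c) y → ∃ λ t → Pair u w t × Walk (X ─ c) y t × ∃ λ b → ¬ X b × t ~ b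
      escape {c} {y} xc (xy , y≢c)
        with reach-exit (X? ─? c) (walk-avoiding y≢c (λ { refl → proj₂ outer-point xc })) (xy , y≢c)
               (λ (xr , _) → proj₂ outer-point xr)
      ... | t , b , walk , t~b , b≢c , b∉ with proj₁ (proj₂ (reach-end walk))
      ...   | inj₁ kt = ⊥-elim (no-outer-edge kt (λ xb → b∉ (xb , b≢c)) t~b)
      ...   | inj₂ pt = t , pt , reach-map proj₂ walk , b , (λ xb → b∉ (xb , b≢c)) , t~b

      toward-other : ∀ {c q y} → Pair u w c → Pair u w q → c ≢ q → (X ─ c) y → Walk (X ─ c) y q
      toward-other pc pq c≢q xy with escape (inj₂ pc) xy
      ... | t , pt , walk , _ = subst (Walk (X ─ _) _) (pair-other pc pq c≢q pt (proj₂ (reach-end walk))) walk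

      other-end : ∀ {t} → Pair u w t → ∃ λ c → Pair u w c × c ≢ t
      other-end (inj₁ refl) = w , inj₂ refl , ends-distinct ∘ sym
      other-end (inj₂ refl) = u , inj₁ refl , ends-distinct

      outer-neighbour : ∀ {t} → Pair u w t → ∃ λ b → ¬ X b × t ~ b
      outer-neighbour pt with other-end pt
      ... | c , pc , c≢t with escape (inj₂ pc) (inj₂ pt , c≢t ∘ sym)
      ...   | t′ , pt′ , walk , b , b∉ , t′~b =
              b , b∉ , subst (_~ b) (pair-other pc pt c≢t pt′ (proj₂ (reach-end walk))) t′~b

      lobe-unlinked : ¬ Walk X u w → edgesWithin X? ≡ 0
      lobe-unlinked ¬link = edges-none (both? X?) no-edge
        where
        u≢w = ends-distinct
        K-empty : ∀ {k} → ¬ K k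
        K-empty kk = ¬link (reach-++ (reach-reverse ~-sym (reach-map proj₁ k↝u)) (reach-map proj₁ k↝w))
          where
          k↝u = toward-other (inj₂ refl) (inj₁ refl) (u≢w ∘ sym) (inj₁ kk , avoids-ends kk ∘ inj₂)
          k↝w = toward-other (inj₁ refl) (inj₂ refl) u≢w (inj₁ kk , avoids-ends kk ∘ inj₁)
        no-edge : ∀ {i j} → Edge i j → ¬ (X i × X j)
        no-edge _       (inj₁ ki , _)       = K-empty ki
        no-edge _       (_ , inj₁ kj)       = K-empty kj
        no-edge (_ , e) (inj₂ (inj₁ refl) , inj₂ (inj₁ refl)) = ~-irrefl e
        no-edge (_ , e) (inj₂ (inj₂ refl) , inj₂ (inj₂ refl)) = ~-irrefl e
        no-edge (_ , e) (inj₂ (inj₁ refl) , inj₂ (inj₂ refl)) = ¬link (step u∈X e (here w∈X))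
        no-edge (_ , e) (inj₂ (inj₂ refl) , inj₂ (inj₁ refl)) = ¬link (step u∈X (~-sym e) (here w∈X))

      lobe-2-connected : Walk X u w → (∀ {c y} → K c → (X ─ c) y → Walk (X ─ c) y u) → TwoConnected _~_ X
      lobe-2-connected link to-u =
        (u , w , u∈X , w∈X , ends-distinct) ,
        connected-via ~-sym u∈X to-u′ ,
        λ { z (inj₁ kz) → connected-via ~-sym (u∈X , avoids-ends kz ∘ inj₁ ∘ sym) (to-u kz)
          ; z (inj₂ (inj₁ refl)) → connected-via ~-sym (w∈X , ends-distinct ∘ sym)
                                     (toward-other (inj₁ refl) (inj₂ refl) ends-distinct)
          ; z (inj₂ (inj₂ refl)) → connected-via ~-sym (u∈X , ends-distinct)
                                     (toward-other (inj₂ refl) (inj₁ refl) (ends-distinct ∘ sym)) }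
        where
        to-u′ : ∀ {y} → X y → Walk X y u
        to-u′ {y} xy with y ≟ w
        ... | yes refl = reach-reverse ~-sym link
        ... | no y≢w   = reach-map proj₁ (toward-other (inj₂ refl) (inj₁ refl) (ends-distinct ∘ sym) (xy , y≢w))

      card-X : card X? ≡ card K? + 2
      card-X = trans (card-∪ K? (pair? u w) avoids-ends) (cong (card K? +_) (card-pair ends-distinct))

      lobe-tight : TwoConnected _~_ X → edgesWithin X? ≡ 2 * card K? + 1
      lobe-tight 2-conn-X = +-cancelʳ-≡ 3 _ _ (begin
        edgesWithin X? + 3              ≡⟨ flat-edges X? 2-conn-X u∈X (proj₂ outer-point) outer-connected ⟩
        2 * card X?                     ≡⟨ cong (2 *_) card-X ⟩
        2 * (card K? + 2)               ≡⟨ arith (card K?) ⟩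
        2 * card K? + 1 + 3             ∎)
        where
        open ≡-Reasoning
        arith : ∀ k → 2 * (k + 2) ≡ 2 * k + 1 + 3
        arith = solve-∀

      in-K : ∀ {v} → X v → v ≢ u → v ≢ w → K v
      in-K (inj₁ kv)        _   _   = kv
      in-K (inj₂ (inj₁ eq)) v≢u _   = ⊥-elim (v≢u eq)
      in-K (inj₂ (inj₂ eq)) _   v≢w = ⊥-elim (v≢w eq)

      module Sublobe {c p q : Fin N} {P : Pred (Fin N) 0ℓ} (kc : K c)
                     (pp : Pair u w p) (pq : Pair u w q) (p≢q : p ≢ q)
                     (P⊆X─c : P ⊆ X ─ c) (p∈P : P p) (q∉P : ¬ P q)
                     (P-closed : ∀ {a b} → P a → (X ─ c) b → a ~ b → P b)
                     (to-q : ∀ {v} → ((X ─ c) ∖ P) v → Walk ((X ─ c) ∖ P) v q) where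

        X′ : Pred (Fin N) 0ℓ
        X′ = (P ─ p) ∪ Pair p c

        X′⇒ : ∀ {v} → X′ v → P v ⊎ v ≡ c
        X′⇒ (inj₁ (pv , _))     = inj₁ pv
        X′⇒ (inj₂ (inj₁ refl)) = inj₁ p∈P
        X′⇒ (inj₂ (inj₂ refl)) = inj₂ refl

        ⇒X′ : ∀ {v} → P v ⊎ v ≡ c → X′ v
        ⇒X′ {v} (inj₁ pv) with v ≟ p
        ... | yes refl = inj₂ (inj₁ refl)
        ... | no v≢p   = inj₁ (pv , v≢p)
        ⇒X′ (inj₂ refl) = inj₂ (inj₂ refl)

        ∉X′ : ∀ {v} → ¬ P v → v ≢ c → ¬ X′ v
        ∉X′ ¬pv v≢c = [ ¬pv , v≢c ]′ ∘ X′⇒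

        q≢c : q ≢ c
        q≢c refl = avoids-ends kc pq

        to-q′ : ∀ {v} → ¬ X′ v → Walk (∁ X′) v q
        to-q′ {v} v∉ with X? v
        ... | yes xv = reach-map (λ ((_ , z≢c) , ¬pz) → ∉X′ ¬pz z≢c)
                         (to-q ((xv , v∉ ∘ ⇒X′ ∘ inj₂) , v∉ ∘ ⇒X′ ∘ inj₁))
        ... | no ¬xv with outer-neighbour pq
        ...   | b , ¬xb , q~b = reach-snoc (reach-map outer⇒ (outer-connected ¬xv ¬xb)) (~-sym q~b) (∉X′ q∉P q≢c)
          where
          outer⇒ : ∀ {z} → ¬ X z → ¬ X′ z
          outer⇒ ¬xz = [ (λ pz → ¬xz (proj₁ (P⊆X─c pz))) , (λ { refl → ¬xz (inj₁ kc) }) ]′ ∘ X′⇒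

        no-edge : ∀ {a b} → (P ─ p) a → ¬ X′ b → ¬ a ~ b
        no-edge {b = b} (pa , a≢p) b∉ e with X? b
        ... | yes xb = b∉ (⇒X′ (inj₁ (P-closed pa (xb , b∉ ∘ ⇒X′ ∘ inj₂) e)))
        ... | no ¬xb with proj₁ (P⊆X─c pa)
        ...   | inj₁ ka  = no-outer-edge ka ¬xb e
        ...   | inj₂ pa′ = q∉P (subst P (pair-other pp pq p≢q pa′ a≢p) pa)

        sublobe : Lobe p c (P ─ p)
        sublobe = record
          { ends-distinct   = proj₂ (P⊆X─c p∈P)
          ; avoids-ends     = λ { (_ , v≢p) (inj₁ refl) → v≢p refl ; (pv , _) (inj₂ refl) → proj₂ (P⊆X─c pv) refl }
          ; outer-point     = q , ∉X′ q∉P q≢c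
          ; outer-connected = λ a∉ b∉ → reach-++ (to-q′ a∉) (reach-reverse ~-sym (to-q′ b∉))
          ; no-outer-edge   = no-edge
          }

      module Cut {c y₀ : Fin N} (kc : K c) (xy₀ : (X ─ c) y₀) (y₀↛u : ¬ Walk (X ─ c) y₀ u)
                 (bound : LobesBelow (card K?)) where

        A : Pred (Fin N) 0ℓ
        A v = Walk (X ─ c) v u

        A? : Decidable A
        A? v = reach? _~?_ (X? ─? c) v u

        B : Pred (Fin N) 0ℓ
        B = (X ─ c) ∖ A

        B? : Decidable B
        B? = (X? ─? c) ∩? ∁? A?

        c∉Pair : ¬ Pair u w c
        c∉Pair = avoids-ends kc

        u∈A : A u
        u∈A = here (inj₂ (inj₁ refl) , c∉Pair ∘ inj₁ ∘ sym)

        w∈B : B w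
        w∈B = (inj₂ (inj₂ refl) , c∉Pair ∘ inj₂ ∘ sym) , λ w↝u → y₀↛u (reach-++ (y₀↝w w↝u) w↝u)
          where
          y₀↝w : A w → Walk (X ─ c) y₀ w
          y₀↝w _ with escape (inj₁ kc) xy₀
          ... | t , inj₁ refl , walk , _ = ⊥-elim (y₀↛u walk)
          ... | t , inj₂ refl , walk , _ = walk

        A-closed : ∀ {a b} → A a → (X ─ c) b → a ~ b → A b
        A-closed a↝u xb e = step xb (~-sym e) a↝u

        B-closed : ∀ {a b} → B a → (X ─ c) b → a ~ b → B b
        B-closed (xa , ¬a↝u) xb e = xb , λ b↝u → ¬a↝u (step xa e b↝u)

        B-to-w : ∀ {v} → B v → Walk B v w
        B-to-w {v} (xv , ¬v↝u) with escape (inj₁ kc) xv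
        ... | t , inj₁ refl , walk , _ = ⊥-elim (¬v↝u walk)
        ... | t , inj₂ refl , walk , _ = reach-map proj₂ (reach-within B-closed (xv , ¬v↝u) walk)

        A-to-u : ∀ {v} → ((X ─ c) ∖ B) v → Walk ((X ─ c) ∖ B) v u
        A-to-u {v} (xv , ¬bv) =
          reach-map (λ (xz , z↝u) → xz , λ (_ , ¬z↝u) → ¬z↝u z↝u) (reach-within A-closed v↝u v↝u)
          where
          v↝u : A v
          v↝u = decidable-stable (A? v) (¬bv ∘ (xv ,_))

        module SA = Sublobe kc (inj₁ refl) (inj₂ refl) ends-distinct reach-start u∈A (proj₂ w∈B) A-closed B-to-w
        module SB = Sublobe kc (inj₂ refl) (inj₁ refl) (ends-distinct ∘ sym) proj₁ w∈B (λ (_ , ¬u↝u) → ¬u↝u u∈A)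
                            B-closed A-to-u

        X-split : edgesWithin X? ≡
                  edgesWithin ((A? ─? u) ∪? pair? u c) + edgesWithin ((B? ─? w) ∪? pair? w c)
        X-split = edgesWithin-∪ X? ((A? ─? u) ∪? pair? u c) ((B? ─? w) ∪? pair? w c)
                    X⊆ (back {A} reach-start ∘ SA.X′⇒) (back {B} proj₁ ∘ SB.X′⇒) shared crossing
          where
          X⊆ : X ⊆ SA.X′ ∪ SB.X′
          X⊆ {v} xv with v ≟ c
          ... | yes refl = inj₁ (SA.⇒X′ (inj₂ refl))
          ... | no v≢c with A? v
          ...   | yes av = inj₁ (SA.⇒X′ (inj₁ av))
          ...   | no ¬av = inj₂ (SB.⇒X′ (inj₁ ((xv , v≢c) , ¬av)))
          back : ∀ {P : Pred (Fin N) 0ℓ} → P ⊆ X ─ c → ∀ {v} → P v ⊎ v ≡ c → X v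
          back P⊆ = [ proj₁ ∘ P⊆ , (λ { refl → inj₁ kc }) ]′
          at-c : ∀ {v} → A v ⊎ v ≡ c → B v ⊎ v ≡ c → v ≡ c
          at-c (inj₂ eq) _                = eq
          at-c (inj₁ _)  (inj₂ eq)        = eq
          at-c (inj₁ av) (inj₁ (_ , ¬av)) = ⊥-elim (¬av av)
          shared : ∀ {a b} → (SA.X′ ∩ SB.X′) a → (SA.X′ ∩ SB.X′) b → a ≡ b
          shared (ya , za) (yb , zb) = trans (at-c (SA.X′⇒ ya) (SB.X′⇒ za)) (sym (at-c (SA.X′⇒ yb) (SB.X′⇒ zb)))
          crossing : ∀ {a b} → SA.X′ a → SB.X′ b → a ~ b → SB.X′ a ⊎ SA.X′ b
          crossing ya zb e with SA.X′⇒ ya | SB.X′⇒ zb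
          ... | inj₂ refl | _         = inj₁ (SB.⇒X′ (inj₂ refl))
          ... | inj₁ _    | inj₂ refl = inj₂ (SA.⇒X′ (inj₂ refl))
          ... | inj₁ av   | inj₁ (xb , ¬bv) = ⊥-elim (¬bv (A-closed av xb e))

        K-split : card K? ≡ card (A? ─? u) + (card (B? ─? w) + 1)
        K-split = trans (card-split (A? ─? u) ((B? ─? w) ∪? (_≟ c)) K? λ v → record
                          { split = to ; fromˡ = from-A ; fromʳ = from-B ; disjoint = disjoint })
                        (cong (card (A? ─? u) +_)
                          (trans (card-∪ (B? ─? w) (_≟ c) λ (((_ , v≢c) , _) , _) v≡c → v≢c v≡c)
                                 (cong (card (B? ─? w) +_) (card-singleton c))))
          where
          to : ∀ {v} → K v → (A ─ u) v ⊎ ((B ─ w) v ⊎ v ≡ c)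
          to {v} kv with v ≟ c
          ... | yes v≡c = inj₂ (inj₂ v≡c)
          ... | no v≢c with A? v
          ...   | yes av = inj₁ (av , avoids-ends kv ∘ inj₁)
          ...   | no ¬av = inj₂ (inj₁ (((inj₁ kv , v≢c) , ¬av) , avoids-ends kv ∘ inj₂))
          from-A : ∀ {v} → (A ─ u) v → K v
          from-A (av , v≢u) = in-K (proj₁ (reach-start av)) v≢u λ { refl → proj₂ w∈B av }
          from-B : ∀ {v} → ((B ─ w) ∪ (_≡ c)) v → K v
          from-B (inj₁ (((xv , _) , ¬av) , v≢w)) = in-K xv (λ { refl → ¬av u∈A }) v≢w
          from-B (inj₂ refl) = kc
          disjoint : ∀ {v} → (A ─ u) v → ((B ─ w) ∪ (_≡ c)) v → ⊥
          disjoint (av , _) (inj₁ ((_ , ¬av) , _)) = ¬av av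
          disjoint (av , _) (inj₂ refl)            = proj₂ (reach-start av) refl

        cut-bound : edgesWithin X? ≤ 2 * card K?
        cut-bound = begin
          edgesWithin X?
            ≡⟨ X-split ⟩
          edgesWithin ((A? ─? u) ∪? pair? u c) + edgesWithin ((B? ─? w) ∪? pair? w c)
            ≤⟨ +-mono-≤ (bound (A? ─? u) SA.sublobe A<K) (bound (B? ─? w) SB.sublobe B<K) ⟩
          (2 * a + 1) + (2 * b + 1)
            ≡⟨ arith a b ⟩
          2 * (a + (b + 1))
            ≡⟨ cong (2 *_) (sym K-split) ⟩
          2 * card K? ∎
          where
          open ≤-Reasoning
          a = card (A? ─? u)
          b = card (B? ─? w)
          arith : ∀ a b → (2 * a + 1) + (2 * b + 1) ≡ 2 * (a + (b + 1))
          arith = solve-∀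
          A<K : a < card K?
          A<K = ≤-trans (m≤m+n (suc a) b) (≤-reflexive (trans (+-suc′ a b) (sym K-split)))
            where
            +-suc′ : ∀ a b → suc a + b ≡ a + (b + 1)
            +-suc′ = solve-∀
          B<K : b < card K?
          B<K = ≤-trans (≤-reflexive (+-comm 1 b)) (≤-trans (m≤n+m (b + 1) a) (≤-reflexive (sym K-split)))

      lobe-step : LobesBelow (card K?) → LobeOutcome u w K?
      lobe-step bound with reach? _~?_ X? u w
      ... | no ¬link = inj₂ (≤-trans (≤-reflexive (lobe-unlinked ¬link)) z≤n)
      ... | yes link
        with any? (λ c → any? (λ y → K? c ×-dec (X? ─? c) y ×-dec ¬? (reach? _~?_ (X? ─? c) y u)))
      ...   | yes (c , y , kc , xy , y↛u) = inj₂ (Cut.cut-bound kc xy y↛u bound)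
      ...   | no ¬obstruction = inj₁ (2-conn-X , lobe-tight 2-conn-X)
        where
        2-conn-X : TwoConnected _~_ X
        2-conn-X = lobe-2-connected link λ {c} {y} kc xy →
          decidable-stable (reach? _~?_ (X? ─? c) y u) λ y↛u → ¬obstruction (c , y , kc , xy , y↛u)

    lobe-dichotomy : ∀ {u w K} (K? : Decidable K) → Lobe u w K → LobeOutcome u w K?
    lobe-dichotomy K? lobe = go K? lobe (<-wellFounded (card K?))
      where
      go : ∀ {u w K} (K? : Decidable K) → Lobe u w K → Acc _<_ (card K?) → LobeOutcome u w K?
      go K? lobe (acc smaller) = LobeFacts.lobe-step K? lobe λ {p} {c} P? lobe′ P<K →
        lobe-outcome-bound {p} {c} P? (go P? lobe′ (smaller P<K))


    record Side (u w : Fin N) (Z : Pred (Fin N) 0ℓ) : Set where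
      field
        ends-distinct : u ≢ w
        inside        : Z ⊆ Away u w
        closed        : ∀ {a b} → Z a → Away u w b → a ~ b → Z b
        point         : ∃ Z
        co-point      : ∃ (Away u w ∖ Z)

    SidesBelow : ℕ → Set₁
    SidesBelow m = ∀ {u w Y} (Y? : Decidable Y) → Side u w Y → card Y? < m →
                   2 * card Y? + 1 ≤ edgesMeeting Y?

    module SideFacts {u w : Fin N} {Z : Pred (Fin N) 0ℓ} (Z? : Decidable Z) (side : Side u w Z) where
      open Side side

      K : Pred (Fin N) 0ℓ
      K = Away u w ∖ Z

      K? : Decidable K
      K? = away? u w ∩? ∁? Z?

      X? : Decidable (K ∪ Pair u w)
      X? = K? ∪? pair? u w

      Z⇒∉X : ∀ {v} → Z v → ¬ (K ∪ Pair u w) v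
      Z⇒∉X zv (inj₁ (_ , ¬zv))   = ¬zv zv
      Z⇒∉X zv (inj₂ (inj₁ refl)) = proj₁ (inside zv) refl
      Z⇒∉X zv (inj₂ (inj₂ refl)) = proj₂ (inside zv) refl

      ∉X⇒Z : ∀ {v} → ¬ (K ∪ Pair u w) v → Z v
      ∉X⇒Z {v} v∉ = decidable-stable (Z? v) λ ¬zv →
        v∉ (inj₁ ((v∉ ∘ inj₂ ∘ inj₁ , v∉ ∘ inj₂ ∘ inj₂) , ¬zv))

      side-lobe : (∀ {a b} → Z a → Z b → Walk Z a b) → Lobe u w K
      side-lobe conn = record
        { ends-distinct   = ends-distinct
        ; avoids-ends     = λ { ((v≢u , _) , _) (inj₁ refl) → v≢u refl ; ((_ , v≢w) , _) (inj₂ refl) → v≢w refl }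
        ; outer-point     = proj₁ point , Z⇒∉X (proj₂ point)
        ; outer-connected = λ a∉ b∉ → reach-map Z⇒∉X (conn (∉X⇒Z a∉) (∉X⇒Z b∉))
        ; no-outer-edge   = λ (wa , ¬za) b∉ e → ¬za (closed (∉X⇒Z b∉) wa (~-sym e))
        }

      X⇒∉Z : ∀ {v} → (K ∪ Pair u w) v → ¬ Z v
      X⇒∉Z xv zv = Z⇒∉X zv xv

      ∉Z⇒X : ∀ {v} → ¬ Z v → (K ∪ Pair u w) v
      ∉Z⇒X ¬zv = decidable-stable (X? _) (¬zv ∘ ∉X⇒Z)

      lobe-bound : (∀ {a b} → Z a → Z b → Walk Z a b) → edgesWithin X? ≤ 2 * card K? + 1
      lobe-bound conn = lobe-outcome-bound {u} {w} K? (lobe-dichotomy K? (side-lobe conn))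

      connected-bound : (∀ {a b} → Z a → Z b → Walk Z a b) → 2 * card Z? + 1 ≤ edgesMeeting Z?
      connected-bound conn = +-cancelˡ-≤ (2 * k + 1) _ _ (begin
        (2 * k + 1) + (2 * card Z? + 1)  ≡⟨ arith k (card Z?) ⟩
        2 * (k + 1 + card Z?)            ≡⟨ sym (edges-total size) ⟩
        edgesWithin U?                   ≡⟨ edges-complement X? Z? X⇒∉Z ∉Z⇒X ⟩
        edgesWithin X? + edgesMeeting Z? ≤⟨ +-monoˡ-≤ _ (lobe-bound conn) ⟩
        (2 * k + 1) + edgesMeeting Z?    ∎)
        where
        open ≤-Reasoning
        k = card K?
        arith : ∀ k z → (2 * k + 1) + (2 * z + 1) ≡ 2 * (k + 1 + z)
        arith = solve-∀
        size : N ≡ suc (k + 1 + card Z?)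
        size = begin-equality
          N                       ≡⟨ card-complement X? Z? X⇒∉Z ∉Z⇒X ⟩
          card X? + card Z?       ≡⟨ cong (_+ card Z?) (LobeFacts.card-X K? (side-lobe conn)) ⟩
          k + 2 + card Z?         ≡⟨ arith′ k (card Z?) ⟩
          suc (k + 1 + card Z?)   ∎
          where
          arith′ : ∀ k z → k + 2 + z ≡ suc (k + 1 + z)
          arith′ = solve-∀

      module Split {a b : Fin N} (za : Z a) (zb : Z b) (a↛b : ¬ Walk Z a b) where

        C : Pred (Fin N) 0ℓ
        C v = Walk Z a v

        C? : Decidable C
        C? v = reach? _~?_ Z? a v

        D : Pred (Fin N) 0ℓ
        D = Z ∖ C

        D? : Decidable D
        D? = Z? ∩? ∁? C?

        C-closed : ∀ {c d} → C c → Away u w d → c ~ d → C d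
        C-closed a↝c wd e = reach-snoc a↝c e (closed (reach-end a↝c) wd e)

        side-C : Side u w C
        side-C = record
          { ends-distinct = ends-distinct
          ; inside        = inside ∘ reach-end
          ; closed        = C-closed
          ; point         = a , here za
          ; co-point      = b , inside zb , a↛b
          }

        side-D : Side u w D
        side-D = record
          { ends-distinct = ends-distinct
          ; inside        = inside ∘ proj₁
          ; closed        = λ (zc , ¬a↝c) wd e → closed zc wd e , λ a↝d → ¬a↝c (reach-snoc a↝d (~-sym e) zc)
          ; point         = b , zb , a↛b
          ; co-point      = a , inside za , λ (_ , ¬a↝a) → ¬a↝a (here za)
          }

        classify : ∀ v → Z v → C v ⊎ D v
        classify v zv = [ inj₁ , (λ ¬cv → inj₂ (zv , ¬cv)) ]′ (toSum (C? v))

        card-Z : card Z? ≡ card C? + card D?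
        card-Z = card-split C? D? Z? λ v → record
          { split    = classify v
          ; fromˡ    = reach-end
          ; fromʳ    = proj₁
          ; disjoint = λ cv (_ , ¬cv) → ¬cv cv
          }

        meeting-Z : edgesMeeting Z? ≡ edgesMeeting C? + edgesMeeting D?
        meeting-Z = edges-split (either? Z?) (either? C?) (either? D?)
          λ {i} {j} (_ , e) → record
            { split    = [ [ inj₁ ∘ inj₁ , inj₂ ∘ inj₁ ]′ ∘ classify i
                         , [ inj₁ ∘ inj₂ , inj₂ ∘ inj₂ ]′ ∘ classify j ]′
            ; fromˡ    = map-⊎ reach-end reach-end
            ; fromʳ    = map-⊎ proj₁ proj₁
            ; disjoint = λ { (inj₁ ci) (inj₁ (_ , ¬ci)) → ¬ci ci
                           ; (inj₂ cj) (inj₂ (_ , ¬cj)) → ¬cj cj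
                           ; (inj₁ ci) (inj₂ (zj , ¬cj)) → ¬cj (C-closed ci (inside zj) e)
                           ; (inj₂ cj) (inj₁ (zi , ¬ci)) → ¬ci (C-closed cj (inside zi) (~-sym e)) }
            }

        split-bound : SidesBelow (card Z?) → 2 * card Z? + 1 < edgesMeeting Z?
        split-bound bound = begin
          suc (2 * card Z? + 1)               ≡⟨ cong (λ z → suc (2 * z + 1)) card-Z ⟩
          suc (2 * (c + d) + 1)               ≡⟨ arith c d ⟩
          (2 * c + 1) + (2 * d + 1)           ≤⟨ +-mono-≤ (bound C? side-C C<Z) (bound D? side-D D<Z) ⟩
          edgesMeeting C? + edgesMeeting D?   ≡⟨ sym meeting-Z ⟩
          edgesMeeting Z?                     ∎
          where
          open ≤-Reasoning
          c = card C?
          d = card D?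
          arith : ∀ c d → suc (2 * (c + d) + 1) ≡ (2 * c + 1) + (2 * d + 1)
          arith = solve-∀
          C<Z : c < card Z?
          C<Z = ≤-trans (m<m+n c (card-pos D? (zb , a↛b))) (≤-reflexive (sym card-Z))
          D<Z : d < card Z?
          D<Z = ≤-trans (m<n+m d (card-pos C? (here za))) (≤-reflexive (sym card-Z))

      side-step : SidesBelow (card Z?) → 2 * card Z? + 1 ≤ edgesMeeting Z?
      side-step bound with any? (λ y → Z? y ×-dec ¬? (reach? _~?_ Z? (proj₁ point) y))
      ... | yes (y , zy , ¬walk) = <⇒≤ (Split.split-bound (proj₂ point) zy ¬walk bound)
      ... | no ¬split = connected-bound λ za zb → reach-++ (reach-reverse ~-sym (from-point za)) (from-point zb)
        where
        from-point : ∀ {y} → Z y → Walk Z (proj₁ point) y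
        from-point {y} zy = decidable-stable (reach? _~?_ Z? (proj₁ point) y) λ ¬walk → ¬split (y , zy , ¬walk)

    side-bound : ∀ {u w Z} (Z? : Decidable Z) → Side u w Z → 2 * card Z? + 1 ≤ edgesMeeting Z?
    side-bound Z? side = go Z? side (<-wellFounded (card Z?))
      where
      go : ∀ {u w Z} (Z? : Decidable Z) → Side u w Z → Acc _<_ (card Z?) → 2 * card Z? + 1 ≤ edgesMeeting Z?
      go Z? side (acc smaller) = SideFacts.side-step Z? side λ Y? side′ Y<Z → go Y? side′ (smaller Y<Z)

    disconnected-side-bound : ∀ {u w Z} (Z? : Decidable Z) → Side u w Z → ∀ {a b} → Z a → Z b → ¬ Walk Z a b →
                              2 * card Z? + 1 < edgesMeeting Z?
    disconnected-side-bound Z? side za zb a↛b =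
      SideFacts.Split.split-bound Z? side za zb a↛b λ Y? side′ _ → side-bound Y? side′

    module Component {u w : Fin N} {Z : Pred (Fin N) 0ℓ} (Z? : Decidable Z) (side : Side u w Z)
                     (conn : ∀ {a b} → Z a → Z b → Walk Z a b) where
      open Side side
      open SideFacts Z? side

      side-K : Side u w K
      side-K = record
        { ends-distinct = ends-distinct
        ; inside        = proj₁
        ; closed        = λ (wa , ¬za) wb e → wb , λ zb → ¬za (closed zb wa (~-sym e))
        ; point         = co-point
        ; co-point      = proj₁ point , inside (proj₂ point) , λ (_ , ¬z) → ¬z (proj₂ point)
        }

      X-edges : edgesWithin X? ≡ edgesMeeting K? + edgesWithin (pair? u w)
      X-edges = edges-split (both? X?) (either? K?) (both? (pair? u w))
        λ {i} {j} (_ , e) → record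
          { split    = λ (xi , xj) → classify xi xj
          ; fromˡ    = [ (λ ki → inj₁ ki , next ki e) , (λ kj → next kj (~-sym e) , inj₁ kj) ]′
          ; fromʳ    = λ (pi , pj) → inj₂ pi , inj₂ pj
          ; disjoint = λ { (inj₁ ((i≢u , i≢w) , _)) (pi , _) → [ i≢u , i≢w ]′ pi
                         ; (inj₂ ((j≢u , j≢w) , _)) (_ , pj) → [ j≢u , j≢w ]′ pj }
          }
        where
        classify : ∀ {i j} → (K ∪ Pair u w) i → (K ∪ Pair u w) j → (K i ⊎ K j) ⊎ (Pair u w i × Pair u w j)
        classify (inj₁ ki) _         = inj₁ (inj₁ ki)
        classify (inj₂ _)  (inj₁ kj) = inj₁ (inj₂ kj)
        classify (inj₂ pi) (inj₂ pj) = inj₂ (pi , pj)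
        next : ∀ {i j} → K i → i ~ j → (K ∪ Pair u w) j
        next (wi , ¬zi) e = decidable-stable (X? _) λ j∉ → ¬zi (closed (∉X⇒Z j∉) wi (~-sym e))

      meeting-K≤X : edgesMeeting K? ≤ edgesWithin X?
      meeting-K≤X = ≤-trans (m≤m+n _ _) (≤-reflexive (sym X-edges))

      complement-connected : ∀ {a b} → K a → K b → Walk K a b
      complement-connected {a} {b} ka kb with reach? _~?_ K? a b
      ... | yes walk = walk
      ... | no a↛b   = ⊥-elim (<-irrefl refl (begin-strict
        2 * card K? + 1   <⟨ disconnected-side-bound K? side-K ka kb a↛b ⟩
        edgesMeeting K?   ≤⟨ meeting-K≤X ⟩
        edgesWithin X?    ≤⟨ lobe-bound conn ⟩
        2 * card K? + 1   ∎))
        where open ≤-Reasoning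

      ends-not-adjacent : ¬ u ~ w
      ends-not-adjacent u~w = <-irrefl refl (begin-strict
        2 * card K? + 1                                 ≤⟨ side-bound K? side-K ⟩
        edgesMeeting K?                                 <⟨ m<m+n _ (edgesWithin-pair-pos u~w) ⟩
        edgesMeeting K? + edgesWithin (pair? u w)       ≡⟨ sym X-edges ⟩
        edgesWithin X?                                  ≤⟨ lobe-bound conn ⟩
        2 * card K? + 1                                 ∎)
        where open ≤-Reasoning

      complement-2-connected : TwoConnected _~_ (∁ Z)
      complement-2-connected with lobe-dichotomy K? (side-lobe conn)
      ... | inj₁ (2-conn-X , _) = 2-connected-≐ (X⇒∉Z , ∉Z⇒X) 2-conn-X
      ... | inj₂ small = ⊥-elim (<-irrefl refl (begin-strict
        2 * card K?       <⟨ n<1+n _ ⟩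
        suc (2 * card K?) ≡⟨ +-comm 1 _ ⟩
        2 * card K? + 1   ≤⟨ side-bound K? side-K ⟩
        edgesMeeting K?   ≤⟨ meeting-K≤X ⟩
        edgesWithin X?    ≤⟨ small ⟩
        2 * card K?       ∎))
        where open ≤-Reasoning

    -- Connected includes nonemptiness, so a disconnected G ∖ {u, w} may a priori be empty.
    away-inhabited : ∀ {u w} → u ≢ w → ∃ (Away u w)
    away-inhabited {u} {w} u≢w with any? (away? u w)
    ... | yes found = found
    ... | no none   = ⊥-elim (<-irrefl refl (begin-strict
      1                                 <⟨ s≤s (s≤s z≤n) ⟩
      2                                 ≤⟨ *-monoʳ-≤ 2 (∸-monoˡ-≤ 1 two≤N) ⟩
      2 * (N ∸ 1)                       ≡⟨ sym edgesWithin-U ⟩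
      edgesWithin U?                    ≤⟨ edges-mono (both? U?) (both? (pair? u w)) (λ _ _ → in-pair , in-pair) ⟩
      edgesWithin (pair? u w)           ≤⟨ edgesWithin-pair≤1 u≢w ⟩
      1                                 ∎))
      where
      open ≤-Reasoning
      in-pair : ∀ {v} → Pair u w v
      in-pair {v} with v ≟ u | v ≟ w
      ... | yes v≡u | _       = inj₁ v≡u
      ... | no _    | yes v≡w = inj₂ v≡w
      ... | no v≢u  | no v≢w  = ⊥-elim (none (v , v≢u , v≢w))
      two≤N : 2 ≤ N
      two≤N = subst (_≤ N) (card-pair u≢w) (≤-trans (card-mono (pair? u w) U? _) (≤-reflexive (card-U N)))

    module Separation {u w : Fin N} (u≢w : u ≢ w) (disconnected : ¬ Connected _~_ (Away u w))
                      {n : ℕ} {H : Fin n → Subset N} (components : AreComponents G (Away u w) n H) where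

      Z : Fin n → Pred (Fin N) 0ℓ
      Z i v = v Subset.∈ H i

      Z? : ∀ i → Decidable (Z i)
      Z? i v = v ∈? H i

      inside : ∀ i → Z i ⊆ Away u w
      inside i = proj₁ (proj₁ components i) _

      connected : ∀ i {a b} → Z i a → Z i b → Walk (Z i) a b
      connected i = proj₂ (proj₁ (proj₂ (proj₁ components i))) _ _

      closed : ∀ i {a b} → Z i a → Away u w b → a ~ b → Z i b
      closed i = proj₂ (proj₂ (proj₁ components i)) _ _

      point : ∀ i → ∃ (Z i)
      point i = proj₁ (proj₁ (proj₂ (proj₁ components i)))

      disjoint : ∀ {i j v} → i ≢ j → Z i v → ¬ Z j v
      disjoint i≢j = proj₁ (proj₂ components) _ _ i≢j _

      cover : ∀ {v} → Away u w v → ∃ λ i → Z i v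
      cover = proj₂ (proj₂ components) _

      side : ∀ i → ∃ (Away u w ∖ Z i) → Side u w (Z i)
      side i co-point = record
        { ends-distinct = u≢w ; inside = inside i ; closed = closed i ; point = point i ; co-point = co-point }

      y : Fin N
      y = proj₁ (away-inhabited u≢w)

      i₀ : Fin n
      i₀ = proj₁ (cover (proj₂ (away-inhabited u≢w)))

      y∈Z₀ : Z i₀ y
      y∈Z₀ = proj₂ (cover (proj₂ (away-inhabited u≢w)))

      co-point₀ : ∃ (Away u w ∖ Z i₀)
      co-point₀ with any? (away? u w ∩? ∁? (Z? i₀))
      ... | yes found = found
      ... | no none   = ⊥-elim (disconnected ((y , inside i₀ y∈Z₀) , λ a b wa wb →
                          reach-map (inside i₀) (connected i₀ (in-Z₀ wa) (in-Z₀ wb))))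
        where
        in-Z₀ : ∀ {v} → Away u w v → Z i₀ v
        in-Z₀ {v} wv = decidable-stable (Z? i₀ v) λ ¬zv → none (v , wv , ¬zv)

      module C₀ = Component (Z? i₀) (side i₀ co-point₀) (connected i₀)

      y₁ : Fin N
      y₁ = proj₁ co-point₀

      j₁ : Fin n
      j₁ = proj₁ (cover (proj₁ (proj₂ co-point₀)))

      y₁∈Z₁ : Z j₁ y₁
      y₁∈Z₁ = proj₂ (cover (proj₁ (proj₂ co-point₀)))

      only-two : ∀ j → Pair i₀ j₁ j
      only-two j with j ≟ i₀ | j ≟ j₁
      ... | yes j≡i₀ | _        = inj₁ j≡i₀
      ... | no _     | yes j≡j₁ = inj₂ j≡j₁
      ... | no j≢i₀  | no j≢j₁  = ⊥-elim (disjoint j≢j₁ y₁∈Zj y₁∈Z₁)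
        where
        h↝y₁ : Walk (Away u w ∖ Z i₀) (proj₁ (point j)) y₁
        h↝y₁ = C₀.complement-connected (inside j (proj₂ (point j)) , disjoint j≢i₀ (proj₂ (point j)))
                                       (proj₂ co-point₀)
        y₁∈Zj : Z j y₁
        y₁∈Zj = proj₂ (reach-end (reach-within (λ zc wd e → closed j zc (proj₁ wd) e) (proj₂ (point j)) h↝y₁))

      co-point : ∀ i → ∃ (Away u w ∖ Z i)
      co-point i with i ≟ i₀
      ... | yes refl = co-point₀
      ... | no i≢i₀  = y , inside i₀ y∈Z₀ , disjoint (i≢i₀ ∘ sym) y∈Z₀

      component-count : n ≡ 2
      component-count =
        two-elements (λ i₀≡j₁ → proj₂ (proj₂ co-point₀) (subst (λ i → Z i y₁) (sym i₀≡j₁) y₁∈Z₁)) only-two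

      complement-2-connected : ∀ i → TwoConnected _~_ (∁ (Z i))
      complement-2-connected i = Component.complement-2-connected (Z? i) (side i (co-point i)) (connected i)
lemma5p4 : (G : Graph) → TwoConnected (Adj G) (All G) → Spade2 G →
    (v₁ v₂ : Fin (Graph.N G)) → v₁ ≢ v₂ →
    ¬ Connected (Adj G) (λ x → x ≢ v₁ × x ≢ v₂) →
    (n : ℕ) (H : Fin n → Subset (Graph.N G)) →
    AreComponents G (λ x → x ≢ v₁ × x ≢ v₂) n H →
    (n ≡ 2)
    × ¬ Adj G v₁ v₂
    × (∀ i → TwoConnected (Adj G) (λ x → x ∉ H i))
lemma5p4 G 2-conn spade v₁ v₂ v₁≢v₂ disconnected n H components =
  component-count , C₀.ends-not-adjacent , complement-2-connected
  where
  open ♠₂ G 2-conn spade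
  open Separation v₁≢v₂ disconnected components
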